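{- Let $n,p>0$ be integers and let $\mathbf{A}=\mathbf{A}^{p+1}_{n+1}$ be as in the context. Then $\mathbf{A}$ is local (it has a unique maximal proper implicative filter), and its maximal proper implicative filter, which equals its radical, is $\mathrm{Rad}(\mathbf{A})=\uparrow\langle(0,0),p\rangle=\{a\in A:a\ge\langle(0,0),p\rangle\}$.
   Context: Fix integers $n,p>0$. On $\mathbb{Z}\times\mathbb{Z}$ use componentwise addition/subtraction and the lexicographic total order $\preccurlyeq$: $(m,r)\preccurlyeq(k,s)$ iff $m<k$, or $m=k$ and $r\le s$; $\max,\min$ are taken with respect to $\preccurlyeq$. For an integer $j\ge 0$ let $L^\omega_{j+1}=\{(m,r)\in\mathbb{Z}^2:(0,0)\preccurlyeq(m,r)\preccurlyeq(j,0)\}$. On $L^\omega_{n+1}$ put $x*y=\max\{(0,0),x+y-(n,0)\}$ and $x\to y=\min\{(n,0),(n,0)-x+y\}$. Let $L_{p+1}=\{0,1,\dots,p\}$ with the usual order and $\alpha*\beta=\max\{0,\alpha+\beta-p\}$. Let $A=A^{p+1}_{n+1}=(L^\omega_{n+1}\times\{0,p\})\cup(L^\omega_{n}\times\{1,\dots,p-1\})$, with elements written $\langle(m,r),\alpha\rangle$; $\bot=\langle(n,0),0\rangle$, $\top=\langle(n,0),p\rangle$. Define $\langle(m,r),\alpha\rangle\le\langle(k,s),\beta\rangle$ iff either (o1) $0<\alpha\le\beta$ and $(m,r)\preccurlyeq(k,s)$; or (o2) $\alpha=\beta=0$ and $(k,s)\preccurlyeq(m,r)$; or (o3) $\alpha=0<\beta$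 and $(n-1,0)\preccurlyeq(m+k,r+s)$. Define the commutative operation $\odot$ on $A$, for $a=\langle(m,r),\alpha\rangle$, $b=\langle(k,s),\beta\rangle$: (i) if $\alpha,\beta>0$ and $\alpha*\beta\neq0$: $a\odot b=\langle(m,r)*(k,s),\alpha*\beta\rangle$; (ii) if $\alpha,\beta>0$ and $\alpha*\beta=0$: $a\odot b=\langle\min\{(n,0),(2n-(m+k+1),-(r+s))\},0\rangle$; (iii) if $\alpha>0$, $\beta=0$: $a\odot b=b\odot a=\langle(m,r)\to(k,s),0\rangle$; (iv) if $\alpha=\beta=0$: $a\odot b=\langle\min\{(n,0),(m+k+1,r+s)\},0\rangle$. Define $\sim\langle(m,r),\alpha\rangle=\langle(m,r),p-\alpha\rangle$ if $\alpha\in\{0,p\}$, and $=\langle(n-1-m,-r),p-\alpha\rangle$ otherwise; $x\multimap y=\sim(x\odot\sim y)$; $\mathbf{A}=\langle A;\odot,\multimap,\wedge,\vee,\bot,\top\rangle$. An implicative filter is a subset $F\subseteq A$ with $\top\in F$, closed under $\odot$, and upward closed; proper means $F\neq A$. $\mathrm{Rad}(\mathbf{A})$ is the intersection of all maximal proper implicative filters. -}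

module Defs where

open import Level using (Level; suc; zero)
open import Data.Nat as ℕ using (ℕ)
open import Data.Integer as ℤ using (ℤ; +_; -_)
open import Data.Product using (_×_; _,_; Σ; ∃)
open import Data.Sum using (_⊎_)
open import Relation.Nullary using (Dec; yes; no; ¬_)
open import Relation.Nullary.Decidable using (_×-dec_; _⊎-dec_)
open import Relation.Binary.PropositionalEquality using (_≡_)
open import Function.Bundles using (_⇔_)

ℤ² : Set
ℤ² = ℤ × ℤ

infix 4 _≼_ _≼?_
_≼_ : ℤ² → ℤ² → Set
(m , r) ≼ (k , s) = (m ℤ.< k) ⊎ (m ≡ k × r ℤ.≤ s)

_≼?_ : (x y : ℤ²) → Dec (x ≼ y)
(m , r) ≼? (k , s) = (m ℤ.<? k) ⊎-dec ((m ℤ.≟ k) ×-dec (r ℤ.≤? s))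

maxL : ℤ² → ℤ² → ℤ²
maxL x y with x ≼? y
... | yes _ = y
... | no  _ = x

minL : ℤ² → ℤ² → ℤ²
minL x y with x ≼? y
... | yes _ = x
... | no  _ = y

_⊕_ : ℤ² → ℤ² → ℤ²
(m , r) ⊕ (k , s) = (m ℤ.+ k , r ℤ.+ s)

_⊖_ : ℤ² → ℤ² → ℤ²
(m , r) ⊖ (k , s) = (m ℤ.- k , r ℤ.- s)

-- L^ω_{j+1} = {x : (0,0) ≼ x ≼ (j,0)}
InLω : ℤ → ℤ² → Set
InLω j x = ((+ 0 , + 0) ≼ x) × (x ≼ (j , + 0))

-- The algebra A^{p+1}_{n+1}, elements ⟨(m,r),α⟩ written as pairs (x , α)

module Alg (n p : ℕ) where

  N : ℤ
  N = + n

  _*L_ : ℤ² → ℤ² → ℤ²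
  x *L y = maxL (+ 0 , + 0) ((x ⊕ y) ⊖ (N , + 0))

  _→L_ : ℤ² → ℤ² → ℤ²
  x →L y = minL (N , + 0) (((N , + 0) ⊖ x) ⊕ y)

  _*p_ : ℕ → ℕ → ℕ
  α *p β = (α ℕ.+ β) ℕ.∸ p

  Elt : Set
  Elt = ℤ² × ℕ

  InA : Elt → Set
  InA (x , α) = (InLω N x × (α ≡ 0 ⊎ α ≡ p))
              ⊎ (InLω (N ℤ.- + 1) x × (0 ℕ.< α × α ℕ.< p))

  ⊥A ⊤A : Elt
  ⊥A = ((N , + 0) , 0)
  ⊤A = ((N , + 0) , p)

  infix 4 _≤A_
  _≤A_ : Elt → Elt → Set
  (x , α) ≤A (y , β) =
      (0 ℕ.< α × α ℕ.≤ β × x ≼ y)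
    ⊎ (α ≡ 0 × β ≡ 0 × y ≼ x)
    ⊎ (α ≡ 0 × 0 ℕ.< β × (N ℤ.- + 1 , + 0) ≼ (x ⊕ y))

  _⊙_ : Elt → Elt → Elt
  ((m , r) , ℕ.zero) ⊙ ((k , s) , ℕ.zero) =
    (minL (N , + 0) (m ℤ.+ k ℤ.+ + 1 , r ℤ.+ s) , 0)
  (x , ℕ.zero) ⊙ (y , ℕ.suc β) = ((y →L x) , 0)
  (x , ℕ.suc α) ⊙ (y , ℕ.zero) = ((x →L y) , 0)
  ((m , r) , α@(ℕ.suc _)) ⊙ ((k , s) , β@(ℕ.suc _)) with α *p β
  ... | ℕ.zero  = (minL (N , + 0) ((+ 2 ℤ.* N) ℤ.- (m ℤ.+ k ℤ.+ + 1) , - (r ℤ.+ s)) , 0)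
  ... | γ@(ℕ.suc _) = (((m , r) *L (k , s)) , γ)

  Subset : Set₁
  Subset = Elt → Set

  IsImplicativeFilter : Subset → Set
  IsImplicativeFilter F =
      (∀ a → F a → InA a)
    × F ⊤A
    × (∀ a b → F a → F b → F (a ⊙ b))
    × (∀ a b → F a → InA b → a ≤A b → F b)

  IsProper : Subset → Set
  IsProper F = Σ Elt λ a → InA a × ¬ F a

  IsMaximalFilter : Subset → Set₁
  IsMaximalFilter F =
      IsImplicativeFilter F
    × IsProper F
    × (∀ (G : Subset) → IsImplicativeFilter G → IsProper G →
         (∀ a → F a → G a) → ∀ a → G a → F a)

  Rad : Elt → Set₁
  Rad a = InA a × (∀ (F : Subset) → IsMaximalFilter F → F a)

  UpTop : Subset
  UpTop a = InA a × (((+ 0 , + 0) , p) ≤A a)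

{-# OPTIONS --safe #-}
module Submission where

-- A proper implicative filter cannot contain an element ⟨x,α⟩ with α < p:
-- squaring strictly lowers a level 0 < α < p (to α * α, or to level 0 in
-- case (ii)), so the filter would reach level 0; there ⟨(0,0),0⟩ is the
-- largest element and its (n+1)-st power is ⊥, which lies below everything.
-- Hence every proper filter is contained in the top level {⟨x,p⟩}, which is
-- exactly ↑⟨(0,0),p⟩ and is itself a proper filter: it is the unique maximal
-- filter, and so also the radical.

open import Defs
open import Data.Nat using (ℕ; _<_)
open import Data.Product using (_×_)
open import Function.Bundles using (_⇔_)

open import Data.Empty using (⊥-elim)
open import Data.Integer as ℤ using (+_; -_; +<+)
import Data.Integer.Properties as ℤP
open import Algebra.Properties.AbelianGroup ℤP.+-0-abelianGroup using (xyx⁻¹≈y)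
open import Data.Nat as ℕ using (zero; suc; z≤n; z<s)
open import Data.Nat.Induction using (<-rec)
import Data.Nat.Properties as ℕP
open import Data.Product using (_,_; proj₁; proj₂)
open import Data.Product.Relation.Binary.Lex.Strict
  using (×-reflexive; ×-transitive; ×-antisymmetric)
open import Data.Product.Relation.Binary.Pointwise.NonDependent using (≡×≡⇒≡)
open import Data.Sum using (inj₁; inj₂)
open import Function.Bundles using (mk⇔; module Equivalence)
open import Relation.Nullary using (yes; no)
open import Relation.Binary.PropositionalEquality

≼-refl : ∀ {x} → x ≼ x
≼-refl = ×-reflexive _≡_ ℤ._<_ ℤ._≤_ ℤP.≤-reflexive (refl , refl)

≼-trans : ∀ {x y z} → x ≼ y → y ≼ z → x ≼ z
≼-trans = ×-transitive {_≈₁_ = _≡_} {_<₁_ = ℤ._<_} {_<₂_ = ℤ._≤_}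
  isEquivalence (resp₂ ℤ._<_) ℤP.<-trans ℤP.≤-trans

≼-antisym : ∀ {x y} → x ≼ y → y ≼ x → x ≡ y
≼-antisym x≼y y≼x = ≡×≡⇒≡
  (×-antisymmetric {_≈₁_ = _≡_} {_<₁_ = ℤ._<_} {_≈₂_ = _≡_} {_<₂_ = ℤ._≤_}
    sym ℤP.<-irrefl ℤP.<-asym ℤP.≤-antisym x≼y y≼x)

≼⇒≤₁ : ∀ {m r k s} → (m , r) ≼ (k , s) → m ℤ.≤ k
≼⇒≤₁ (inj₁ m<k)       = ℤP.<⇒≤ m<k
≼⇒≤₁ (inj₂ (refl , _)) = ℤP.≤-refl

+≤+⇒≼ : ∀ {j k r} → j ℕ.≤ k → (+ j , r) ≼ (+ k , r)
+≤+⇒≼ j≤k with ℕP.m≤n⇒m<n∨m≡n j≤k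
... | inj₁ j<k  = inj₁ (+<+ j<k)
... | inj₂ refl = ≼-refl

≼-maxL : ∀ x y → x ≼ maxL x y
≼-maxL x y with x ≼? y
... | yes x≼y = x≼y
... | no _    = ≼-refl

maxL-lub : ∀ {x y z} → x ≼ z → y ≼ z → maxL x y ≼ z
maxL-lub {x} {y} x≼z y≼z with x ≼? y
... | yes _ = y≼z
... | no _  = x≼z

minL-≽ : ∀ {x y} → y ≼ x → minL x y ≡ y
minL-≽ {x} {y} y≼x with x ≼? y
... | yes x≼y = ≼-antisym x≼y y≼x
... | no _    = refl

⊕⊖-≼ : ∀ {x z} y → x ≼ z → (x ⊕ y) ⊖ z ≼ y
⊕⊖-≼ {m , r} {k , t} (j , s) (inj₁ m<k) =
  inj₁ (subst (m ℤ.+ j ℤ.- k ℤ.<_) (xyx⁻¹≈y k j)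
    (ℤP.+-monoˡ-< (- k) (ℤP.+-monoˡ-< j m<k)))
⊕⊖-≼ {m , r} {.m , t} (j , s) (inj₂ (refl , r≤t)) =
  inj₂ (xyx⁻¹≈y m j , subst (r ℤ.+ s ℤ.- t ℤ.≤_) (xyx⁻¹≈y t s)
    (ℤP.+-monoˡ-≤ (- t) (ℤP.+-monoˡ-≤ s r≤t)))

module ImplicativeFilters (n p : ℕ) where
  open Alg n p

  private variable
    G : Subset
    a b : Elt
    x : ℤ²
    α : ℕ

  origin≼N : (+ 0 , + 0) ≼ (N , + 0)
  origin≼N = +≤+⇒≼ z≤n

  InA⇒InLω : InA (x , α) → InLω N x
  InA⇒InLω (inj₁ (x∈L , _))           = x∈L
  InA⇒InLω (inj₂ ((0≼x , x≼N-1) , _)) = 0≼x , ≼-trans x≼N-1 (inj₁ (ℤP.m⊖1+n<m n 1))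

  InA⇒≤p : InA (x , α) → α ℕ.≤ p
  InA⇒≤p (inj₁ (_ , inj₁ refl)) = z≤n
  InA⇒≤p (inj₁ (_ , inj₂ refl)) = ℕP.≤-refl
  InA⇒≤p (inj₂ (_ , _ , α<p))   = ℕP.<⇒≤ α<p

  ⊥A-least : InA b → ⊥A ≤A b
  ⊥A-least {y , zero}        b∈A = inj₂ (inj₁ (refl , refl , proj₂ (InA⇒InLω b∈A)))
  ⊥A-least {(m , r) , suc β} b∈A = inj₂ (inj₂ (refl , z<s , inj₁ N-1<N+m))
    where
    N-1<N+m : N ℤ.- + 1 ℤ.< N ℤ.+ m
    N-1<N+m = ℤP.<-≤-trans (ℤP.m⊖1+n<m n 1)
      (ℤP.i≤i+j N m {{ℤ.nonNegative (≼⇒≤₁ (proj₁ (InA⇒InLω b∈A)))}})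

  level₀ : ℕ → Elt
  level₀ j = ((+ j , + 0) , 0)

  level₀∈A : InA (level₀ 0)
  level₀∈A = inj₁ ((≼-refl , origin≼N) , inj₁ refl)

  level₀-suc : ∀ {j} → suc j ℕ.≤ n → level₀ j ⊙ level₀ 0 ≡ level₀ (suc j)
  level₀-suc {j} j<n = begin
    (minL (N , + 0) (+ (j ℕ.+ 0 ℕ.+ 1) , + 0) , 0)
      ≡⟨ cong (λ i → (minL (N , + 0) (+ i , + 0) , 0)) j+0+1≡1+j ⟩
    (minL (N , + 0) (+ suc j , + 0) , 0)
      ≡⟨ cong (_, 0) (minL-≽ (+≤+⇒≼ j<n)) ⟩
    level₀ (suc j) ∎
    where
    open ≡-Reasoning
    j+0+1≡1+j : j ℕ.+ 0 ℕ.+ 1 ≡ suc j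
    j+0+1≡1+j = trans (cong (ℕ._+ 1) (ℕP.+-identityʳ j)) (ℕP.+-comm j 1)

  square-level-< : ∀ x → 0 < α → α < p → proj₂ ((x , α) ⊙ (x , α)) < α
  square-level-< {suc a} (m , r) _ α<p with suc a *p suc a in eq
  ... | zero  = z<s
  ... | suc _ = subst (_< suc a) eq
    (ℕP.m<n+o⇒m∸n<o (suc a ℕ.+ suc a) p (ℕP.+-monoˡ-< (suc a) α<p))

  module _ (isF : IsImplicativeFilter G) where
    private
      ⊆A : G a → InA a
      ⊆A = proj₁ isF _

      ⊙-closed : G a → G b → G (a ⊙ b)
      ⊙-closed = proj₁ (proj₂ (proj₂ isF)) _ _

      ↑-closed : G a → InA b → a ≤A b → G b
      ↑-closed = proj₂ (proj₂ (proj₂ isF)) _ _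

    ∋level₀ : G (level₀ 0) → ∀ j → j ℕ.≤ n → G (level₀ j)
    ∋level₀ g zero    _   = g
    ∋level₀ g (suc j) j<n =
      subst G (level₀-suc j<n) (⊙-closed (∋level₀ g j (ℕP.<⇒≤ j<n)) g)

    ∋level-zero⇒∋⊥ : G (x , 0) → G ⊥A
    ∋level-zero⇒∋⊥ g = ∋level₀ g₀ n ℕP.≤-refl
      where
      g₀ : G (level₀ 0)
      g₀ = ↑-closed g level₀∈A (inj₂ (inj₁ (refl , refl , proj₁ (InA⇒InLω (⊆A g)))))

    ∋below-p⇒∋⊥ : α < p → G (x , α) → G ⊥A
    ∋below-p⇒∋⊥ {α} {x} = <-rec Below step α x
      where
      Below : ℕ → Set
      Below α = ∀ x → α < p → G (x , α) → G ⊥A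

      step : ∀ α → (∀ {β} → β < α → Below β) → Below α
      step zero    _   x _   g = ∋level-zero⇒∋⊥ g
      step (suc a) rec x α<p g = rec square<α _ (ℕP.<-trans square<α α<p) (⊙-closed g g)
        where square<α = square-level-< x z<s α<p

    proper⇒top-level : IsProper G → G (x , α) → α ≡ p
    proper⇒top-level (b , b∈A , b∉G) g with ℕP.m≤n⇒m<n∨m≡n (InA⇒≤p (⊆A g))
    ... | inj₂ α≡p = α≡p
    ... | inj₁ α<p = ⊥-elim (b∉G (↑-closed (∋below-p⇒∋⊥ α<p g) b∈A (⊥A-least b∈A)))

module TopLevel (n p-1 : ℕ) where
  p : ℕ
  p = suc p-1

  open Alg n p
  open ImplicativeFilters n p

  private variable
    x : ℤ²
    α : ℕ

  UpTop⇒top-level : UpTop (x , α) → α ≡ p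
  UpTop⇒top-level (x∈A , inj₁ (_ , p≤α , _)) = ℕP.≤-antisym (InA⇒≤p x∈A) p≤α
  UpTop⇒top-level (_ , inj₂ (inj₁ (() , _)))
  UpTop⇒top-level (_ , inj₂ (inj₂ (() , _)))

  InLω⇒UpTop : ∀ {x} → InLω N x → UpTop (x , p)
  InLω⇒UpTop x∈L = inj₁ (x∈L , inj₂ refl) , inj₁ (z<s , ℕP.≤-refl , proj₁ x∈L)

  ⊙-top-level : ∀ x y → (x , p) ⊙ (y , p) ≡ (x *L y , p)
  ⊙-top-level (m , r) (k , s) with p *p p | ℕP.m+n∸n≡m p p
  ... | _ | refl = refl

  *L-InLω : ∀ {x y} → InLω N x → InLω N y → InLω N (x *L y)
  *L-InLω {x} {y} (_ , x≼N) (0≼y , y≼N) =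
    ≼-maxL (+ 0 , + 0) ((x ⊕ y) ⊖ (N , + 0)) , ≼-trans (maxL-lub 0≼y (⊕⊖-≼ y x≼N)) y≼N

  UpTop-isImplicativeFilter : IsImplicativeFilter UpTop
  UpTop-isImplicativeFilter =
    (λ _ → proj₁) , InLω⇒UpTop (origin≼N , ≼-refl) , ⊙-closed , ↑-closed
    where
    ⊙-closed : ∀ a b → UpTop a → UpTop b → UpTop (a ⊙ b)
    ⊙-closed (x , α) (y , β) a∈U b∈U
      with refl ← UpTop⇒top-level a∈U | refl ← UpTop⇒top-level b∈U =
      subst UpTop (sym (⊙-top-level x y))
        (InLω⇒UpTop (*L-InLω (InA⇒InLω (proj₁ a∈U)) (InA⇒InLω (proj₁ b∈U))))

    ↑-closed : ∀ a b → UpTop a → InA b → a ≤A b → UpTop b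
    ↑-closed (x , α) (y , β) a∈U b∈A a≤b with refl ← UpTop⇒top-level a∈U | a≤b
    ... | inj₁ (_ , p≤β , x≼y) =
      b∈A , inj₁ (z<s , p≤β , ≼-trans (proj₁ (InA⇒InLω (proj₁ a∈U))) x≼y)
    ... | inj₂ (inj₁ (() , _))
    ... | inj₂ (inj₂ (() , _))

  UpTop-isProper : IsProper UpTop
  UpTop-isProper =
    ⊥A , inj₁ ((origin≼N , ≼-refl) , inj₁ refl) , λ ⊥∈U → ℕP.0≢1+n (UpTop⇒top-level ⊥∈U)

  proper⇒⊆UpTop : ∀ {G} → IsImplicativeFilter G → IsProper G → ∀ a → G a → UpTop a
  proper⇒⊆UpTop isF proper (x , α) g with refl ← proper⇒top-level isF proper g =
    InLω⇒UpTop (InA⇒InLω (proj₁ isF _ g))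

  UpTop-isMaximal : IsMaximalFilter UpTop
  UpTop-isMaximal =
    UpTop-isImplicativeFilter , UpTop-isProper , λ G isF proper _ → proper⇒⊆UpTop isF proper

  maximal⇔UpTop : ∀ F → IsMaximalFilter F → ∀ a → F a ⇔ UpTop a
  maximal⇔UpTop F (isF , proper , maximal) a = mk⇔
    (proper⇒⊆UpTop isF proper a)
    (maximal UpTop UpTop-isImplicativeFilter UpTop-isProper (proper⇒⊆UpTop isF proper) a)

corollary3p3 : (n p : ℕ) → 0 < n → 0 < p →
    Alg.IsMaximalFilter n p (Alg.UpTop n p)
    × (∀ (F : Alg.Subset n p) → Alg.IsMaximalFilter n p F →
         ∀ a → F a ⇔ Alg.UpTop n p a)
    × (∀ a → Alg.Rad n p a → Alg.UpTop n p a)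
    × (∀ a → Alg.UpTop n p a → Alg.Rad n p a)
corollary3p3 n (suc p-1) _ _ =
    UpTop-isMaximal
  , maximal⇔UpTop
  , (λ a (_ , ∈every-maximal) → ∈every-maximal UpTop UpTop-isMaximal)
  , (λ a a∈U → proj₁ a∈U , λ F isMax → Equivalence.from (maximal⇔UpTop F isMax a) a∈U)
  where
  open Alg n (suc p-1) using (UpTop)
  open TopLevel n p-1
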